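{- Let $\mathcal B$ be a building set on a finite set $V$ and $B,B',P\in\mathcal B$ such that $B\ne B'$ are both strictly contained in $P$ and are both inclusion-maximal among the blocks of $\mathcal B$ strictly contained in $P$. Then $(B,B',P)$ is an exchange frame.
   Context: A building set on $V$ is a set $\mathcal B$ of non-empty subsets of $V$ containing all singletons such that $B\cap B'\ne\varnothing$ implies $B\cup B'\in\mathcal B$; $\kappa(\mathcal B)$ is its set of inclusion-maximal blocks. A $\mathcal B$-nested set is $\mathcal N\subseteq\mathcal B$ whose members are pairwise nested or disjoint, such that no union of $k\ge2$ pairwise disjoint members belongs to $\mathcal B$, and with $\kappa(\mathcal B)\subseteq\mathcal N$. If $\mathcal N,\mathcal N'$ are inclusion-maximal nested sets with $\mathcal N\setminus\{B\}=\mathcal N'\setminus\{B'\}$, $B\ne B'$, then the set $\{C\in\mathcal N:B\subsetneq C\}=\{C\in\mathcal N':B'\subsetneq C\}$ has a unique inclusion-minimal element $P$, called the parent, and $(B,B',P)$ is the frame of this exchange. An exchange frame is a triple that is the frame of some such exchange. -}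

module Defs where

open import Data.Nat using (ℕ; _≥_)
open import Data.Bool using (Bool; T)
open import Data.Fin using (Fin)
open import Data.Fin.Subset using (Subset; _⊆_; _⊂_; _∩_; _∪_; ⋃; ⁅_⁆; Empty; Nonempty)
open import Data.List using (List; length)
open import Data.List.Relation.Unary.All using (All)
open import Data.List.Relation.Unary.AllPairs using (AllPairs)
open import Data.Product using (Σ; _×_; ∃-syntax)
open import Data.Sum using (_⊎_)
open import Relation.Nullary using (¬_)
open import Relation.Binary.PropositionalEquality using (_≡_; _≢_)

-- The ground set V is Fin n.  A family of subsets of V (a set of subsets
-- of a finite set) is given by its characteristic function.
Family : ℕ → Set
Family n = Subset n → Bool

infix 4 _∈ᶠ_
_∈ᶠ_ : {n : ℕ} → Subset n → Family n → Set
X ∈ᶠ 𝓕 = T (𝓕 X)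

record IsBuildingSet {n : ℕ} (𝓑 : Family n) : Set where
  field
    nonempty  : ∀ X → X ∈ᶠ 𝓑 → Nonempty X
    singleton : ∀ (v : Fin n) → ⁅ v ⁆ ∈ᶠ 𝓑
    union     : ∀ X Y → X ∈ᶠ 𝓑 → Y ∈ᶠ 𝓑 → Nonempty (X ∩ Y) → (X ∪ Y) ∈ᶠ 𝓑

IsMaximalBlock : {n : ℕ} → Family n → Subset n → Set
IsMaximalBlock 𝓑 X = X ∈ᶠ 𝓑 × (∀ Y → Y ∈ᶠ 𝓑 → X ⊆ Y → Y ≡ X)

Disjoint : {n : ℕ} → Subset n → Subset n → Set
Disjoint X Y = Empty (X ∩ Y)

record IsNested {n : ℕ} (𝓑 : Family n) (𝓝 : Family n) : Set where
  field
    sub      : ∀ X → X ∈ᶠ 𝓝 → X ∈ᶠ 𝓑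
    laminar  : ∀ X Y → X ∈ᶠ 𝓝 → Y ∈ᶠ 𝓝 → X ⊆ Y ⊎ Y ⊆ X ⊎ Disjoint X Y
    noUnion  : ∀ (Xs : List (Subset n)) → length Xs ≥ 2 →
               All (λ X → X ∈ᶠ 𝓝) Xs → AllPairs Disjoint Xs →
               ¬ (⋃ Xs ∈ᶠ 𝓑)
    maxBlocks : ∀ X → IsMaximalBlock 𝓑 X → X ∈ᶠ 𝓝

IsMaximalNested : {n : ℕ} → Family n → Family n → Set
IsMaximalNested 𝓑 𝓝 =
  IsNested 𝓑 𝓝 × (∀ 𝓝' → IsNested 𝓑 𝓝' → (∀ X → X ∈ᶠ 𝓝 → X ∈ᶠ 𝓝') →
                    ∀ X → X ∈ᶠ 𝓝' → X ∈ᶠ 𝓝)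

RemoveEq : {n : ℕ} → Family n → Subset n → Family n → Subset n → Set
RemoveEq 𝓝 B 𝓝' B' =
  ∀ X → ((X ∈ᶠ 𝓝 × X ≢ B) → (X ∈ᶠ 𝓝' × X ≢ B')) ×
        ((X ∈ᶠ 𝓝' × X ≢ B') → (X ∈ᶠ 𝓝 × X ≢ B))

Above : {n : ℕ} → Family n → Subset n → Subset n → Set
Above 𝓝 B C = C ∈ᶠ 𝓝 × B ⊂ C

IsMinimalIn : {n : ℕ} → (Subset n → Set) → Subset n → Set
IsMinimalIn S P = S P × (∀ C → S C → C ⊆ P → C ≡ P)

IsUniqueMinimal : {n : ℕ} → (Subset n → Set) → Subset n → Set
IsUniqueMinimal S P = IsMinimalIn S P × (∀ Q → IsMinimalIn S Q → Q ≡ P)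

IsExchangeFrame : {n : ℕ} → Family n → Subset n → Subset n → Subset n → Set
IsExchangeFrame {n} 𝓑 B B' P =
  Σ (Family n) λ 𝓝 → Σ (Family n) λ 𝓝' →
    IsMaximalNested 𝓑 𝓝 × IsMaximalNested 𝓑 𝓝' ×
    B ∈ᶠ 𝓝 × B' ∈ᶠ 𝓝' × B ≢ B' × RemoveEq 𝓝 B 𝓝' B' ×
    IsUniqueMinimal (Above 𝓝 B) P × IsUniqueMinimal (Above 𝓝' B') P

{-# OPTIONS --safe #-}
-- Rank the ground set so that P ∖ {b, b′} comes first, then b, then b′, then V ∖ P, where
-- b ∈ B ∖ B′ and b′ ∈ B′ ∖ B. For an injective ranking r, the components
-- C v = largest block containing v among the vertices of rank ≤ r v form a maximal nested
-- set. For the ranking above, C b = B (B is maximal below P and avoids b′) and C b′ = P.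
-- Exchanging the ranks of b and b′ leaves every other C v unchanged and turns B into B′,
-- with P still the smallest member above; so the two maximal nested sets realise the frame.
module Submission where

open import Defs
import Data.Bool.Properties as Bool
open import Data.Bool.Properties using (T?)
open import Data.Empty using (⊥-elim)
open import Data.Fin as F using (Fin; toℕ; combine)
open import Data.Fin.Patterns using (0F; 1F; 2F; 3F)
open import Data.Fin.Properties using (any?; _≟_; toℕ-injective; combine-injectiveʳ; combine-monoˡ-<)
open import Data.Fin.Subset
open import Data.Fin.Subset.Induction using (Acc; acc; ⊃-wellFounded)
open import Data.Fin.Subset.Properties
open import Data.List using (List; []; _∷_; [_]; length; filter; allFin; deduplicate; cartesianProductWith)
open import Data.List.Membership.Propositional using () renaming (_∈_ to _∈ˡ_)
open import Data.List.Membership.Propositional.Properties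
  using (∈-cartesianProductWith⁺; ∈-filter⁺; ∈-deduplicate⁺; ∈-allFin)
open import Data.List.Relation.Unary.All as All using (All; []; _∷_)
open import Data.List.Relation.Unary.All.Properties using (all-filter; deduplicate⁺)
open import Data.List.Relation.Unary.AllPairs using (AllPairs; []; _∷_)
open import Data.List.Relation.Unary.Any using (here; there)
open import Data.List.Extrema.Nat using (argmax; argmax-all; f[xs]≤f[argmax])
open import Data.List.Relation.Unary.Unique.Propositional using (Unique)
open import Data.List.Relation.Unary.Unique.DecPropositional.Properties using (deduplicate-!)
open import Data.Nat using (ℕ; zero; suc; _≤_; _<_; _≥_; _≤?_; s≤s; z≤n)
open import Data.Nat.Properties using (≤-refl; ≤-trans; ≤-total; ≤-antisym; <⇒≤; <⇒≱)
open import Data.Product using (_×_; _,_; proj₁; proj₂; ∃-syntax; swap)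
open import Data.Sum using (_⊎_; inj₁; inj₂; [_,_]′)
open import Data.Vec using ([]; _∷_)
open import Data.Vec.Properties using (≡-dec)
open import Relation.Binary.Definitions using (DecidableEquality)
open import Relation.Nullary using (¬_; yes; no; ¬?)
open import Relation.Nullary.Decidable using (isYes; decidable-stable; toWitness; fromWitness; _×-dec_)
open import Relation.Unary using (Decidable)
open import Relation.Binary.PropositionalEquality using (_≡_; _≢_; refl; sym; trans; cong; subst; subst₂)
open import Function using (_∘_; case_of_)

module _ {n : ℕ} where

  _≟ˢ_ : DecidableEquality (Subset n)
  _≟ˢ_ = ≡-dec Bool._≟_

  ⊈⇒∃∉ : {X Y : Subset n} → ¬ X ⊆ Y → ∃[ x ] x ∈ X × x ∉ Y
  ⊈⇒∃∉ {X} {Y} X⊈Y with any? (λ x → x ∈? X ×-dec ¬? (x ∈? Y))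
  ... | yes witness = witness
  ... | no none = ⊥-elim (X⊈Y (λ {x} x∈X → decidable-stable (x ∈? Y) (λ x∉Y → none (x , x∈X , x∉Y))))

  ⊆∧≢⇒⊂ : {X Y : Subset n} → X ⊆ Y → X ≢ Y → X ⊂ Y
  ⊆∧≢⇒⊂ {X} {Y} X⊆Y X≢Y with Y ⊆? X
  ... | yes Y⊆X = ⊥-elim (X≢Y (⊆-antisym X⊆Y Y⊆X))
  ... | no Y⊈X = X⊆Y , ⊈⇒∃∉ Y⊈X

  ∈⋃⁺ : ∀ {x X} (Xs : List (Subset n)) → X ∈ˡ Xs → x ∈ X → x ∈ ⋃ Xs
  ∈⋃⁺ _ (here refl) x∈X = x∈p∪q⁺ (inj₁ x∈X)
  ∈⋃⁺ (_ ∷ Xs) (there X∈Xs) x∈X = x∈p∪q⁺ (inj₂ (∈⋃⁺ Xs X∈Xs x∈X))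

  ∈⋃⁻ : ∀ {x} (Xs : List (Subset n)) → x ∈ ⋃ Xs → ∃[ X ] X ∈ˡ Xs × x ∈ X
  ∈⋃⁻ [] x∈⊥ = ⊥-elim (∉⊥ x∈⊥)
  ∈⋃⁻ (X ∷ Xs) x∈⋃ with x∈p∪q⁻ X (⋃ Xs) x∈⋃
  ... | inj₁ x∈X = X , here refl , x∈X
  ... | inj₂ x∈⋃Xs with ∈⋃⁻ Xs x∈⋃Xs
  ...   | Y , Y∈Xs , x∈Y = Y , there Y∈Xs , x∈Y

  ⋃⊈∈ : ∀ {X} {Xs : List (Subset n)} → 2 ≤ length Xs → All Nonempty Xs →
    AllPairs Disjoint Xs → X ∈ˡ Xs → ¬ ⋃ Xs ⊆ X
  ⋃⊈∈ {Xs = _ ∷ []} (s≤s ()) _ _ _ _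
  ⋃⊈∈ {Xs = Xs@(_ ∷ _ ∷ _)} _ (_ ∷ (b , b∈B) ∷ _) ((A∩B≡∅ ∷ _) ∷ _) (here refl) ⋃⊆A =
    A∩B≡∅ (b , x∈p∩q⁺ (⋃⊆A (∈⋃⁺ Xs (there (here refl)) b∈B) , b∈B))
  ⋃⊈∈ {Xs = Xs@(_ ∷ _ ∷ _)} _ ((a , a∈A) ∷ _) (A∩Xs≡∅ ∷ _) (there X∈Xs) ⋃⊆X =
    All.lookup A∩Xs≡∅ X∈Xs (a , x∈p∩q⁺ (a∈A , ⋃⊆X (∈⋃⁺ Xs (here refl) a∈A)))

subsets : ∀ n → List (Subset n)
subsets zero = [ [] ]
subsets (suc n) = cartesianProductWith _∷_ (inside ∷ outside ∷ []) (subsets n)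

∈-subsets : ∀ {n} (X : Subset n) → X ∈ˡ subsets n
∈-subsets [] = here refl
∈-subsets (inside ∷ X) =
  ∈-cartesianProductWith⁺ _∷_ {xs = inside ∷ outside ∷ []} (here refl) (∈-subsets X)
∈-subsets (outside ∷ X) =
  ∈-cartesianProductWith⁺ _∷_ {xs = inside ∷ outside ∷ []} (there (here refl)) (∈-subsets X)

allPairs-≢ : ∀ {A : Set} {P : A → Set} {R : A → A → Set} →
  (∀ {x y} → P x → P y → x ≢ y → R x y) →
  ∀ {xs} → All P xs → Unique xs → AllPairs R xs
allPairs-≢ R-≢ [] [] = []
allPairs-≢ R-≢ (px ∷ pxs) (x≢xs ∷ u) =
  All.zipWith (λ (py , x≢y) → R-≢ px py x≢y) (pxs , x≢xs) ∷ allPairs-≢ R-≢ pxs u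

module _ {n : ℕ} where

  Maximal : (Subset n → Set) → Subset n → Set
  Maximal F M = F M × ¬ (∃[ X ] F X × M ⊂ X)

  maximal-⊆ : ∀ {F M X} → Maximal F M → F X → M ⊆ X → X ≡ M
  maximal-⊆ {M = M} {X} (_ , ¬larger) FX M⊆X with M ≟ˢ X
  ... | yes M≡X = sym M≡X
  ... | no M≢X = ⊥-elim (¬larger (X , FX , ⊆∧≢⇒⊂ M⊆X M≢X))

  module _ {F : Subset n → Set} (F? : Decidable F) where

    maximal? : Decidable (Maximal F)
    maximal? M = F? M ×-dec ¬? (anySubset? (λ X → F? X ×-dec M ⊂? X))

    maximal-above : ∀ {W} → F W → ∃[ M ] Maximal F M × W ⊆ M
    maximal-above = go (⊃-wellFounded _)
      where
      go : ∀ {W} → Acc _⊃_ W → F W → ∃[ M ] Maximal F M × W ⊆ M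
      go {W} (acc larger) FW with anySubset? (λ X → F? X ×-dec W ⊂? X)
      ... | no ¬larger = W , (FW , ¬larger) , ⊆-refl
      ... | yes (X , FX , W⊂X) with go (larger W⊂X) FX
      ...   | M , M-max , X⊆M = M , M-max , ⊆-trans (p⊂q⇒p⊆q W⊂X) X⊆M

    maximals : List (Subset n)
    maximals = deduplicate _≟ˢ_ (filter maximal? (subsets n))

    ∈-maximals : ∀ {M} → Maximal F M → M ∈ˡ maximals
    ∈-maximals M-max = ∈-deduplicate⁺ _≟ˢ_ (∈-filter⁺ maximal? (∈-subsets _) M-max)

    maximals-maximal : All (Maximal F) maximals
    maximals-maximal = deduplicate⁺ _≟ˢ_ (all-filter maximal? (subsets n))

    maximals-unique : Unique maximals
    maximals-unique = deduplicate-! _≟ˢ_ (filter maximal? (subsets n))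

ProperCover : ∀ {n} → Family n → Subset n → Set
ProperCover 𝓜 Z = ∀ {z} → z ∈ Z → ∃[ W ] W ∈ᶠ 𝓜 × W ⊂ Z × z ∈ W

module _ {n : ℕ} {𝓑 𝓜 : Family n} (𝓜-nested : IsNested 𝓑 𝓜) where
  open IsNested 𝓜-nested

  ¬⋃-cover : ∀ {Z} → Z ∈ᶠ 𝓑 → Nonempty Z → (Xs : List (Subset n)) →
    All (λ X → X ∈ᶠ 𝓜 × X ⊂ Z) Xs → AllPairs Disjoint Xs → ¬ Z ⊆ ⋃ Xs
  ¬⋃-cover Z∈𝓑 (z , z∈Z) [] _ _ Z⊆⋃ = ∉⊥ (Z⊆⋃ z∈Z)
  ¬⋃-cover Z∈𝓑 _ (X ∷ []) ((_ , _ , y , y∈Z , y∉X) ∷ []) _ Z⊆⋃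
    with x∈p∪q⁻ X ⊥ (Z⊆⋃ y∈Z)
  ... | inj₁ y∈X = y∉X y∈X
  ... | inj₂ y∈⊥ = ∉⊥ y∈⊥
  ¬⋃-cover {Z} Z∈𝓑 _ Xs@(_ ∷ _ ∷ _) inside-Z disjoint Z⊆⋃ =
    noUnion Xs (s≤s (s≤s z≤n)) (All.map proj₁ inside-Z) disjoint (subst (_∈ᶠ 𝓑) (sym ⋃≡Z) Z∈𝓑)
    where
    ⋃≡Z : ⋃ Xs ≡ Z
    ⋃≡Z = ⊆-antisym (λ x∈⋃ → let (X , X∈Xs , x∈X) = ∈⋃⁻ Xs x∈⋃ in
                                proj₁ (proj₂ (All.lookup inside-Z X∈Xs)) x∈X)
                    Z⊆⋃

  maximal-members-disjoint : ∀ {F : Subset n → Set} → (∀ {X} → F X → X ∈ᶠ 𝓜) →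
    ∀ {X Y} → Maximal F X → Maximal F Y → X ≢ Y → Disjoint X Y
  maximal-members-disjoint F⊆𝓜 {X} {Y} X-max Y-max X≢Y
    with laminar X Y (F⊆𝓜 (proj₁ X-max)) (F⊆𝓜 (proj₁ Y-max))
  ... | inj₁ X⊆Y = ⊥-elim (X≢Y (sym (maximal-⊆ X-max (proj₁ Y-max) X⊆Y)))
  ... | inj₂ (inj₁ Y⊆X) = ⊥-elim (X≢Y (maximal-⊆ Y-max (proj₁ X-max) Y⊆X))
  ... | inj₂ (inj₂ X∩Y≡∅) = X∩Y≡∅

  ¬ProperCover : ∀ {Z} → Z ∈ᶠ 𝓑 → Nonempty Z → ¬ ProperCover 𝓜 Z
  ¬ProperCover {Z} Z∈𝓑 Z≢∅ cover =
    ¬⋃-cover Z∈𝓑 Z≢∅ (maximals F?) (All.map proj₁ (maximals-maximal F?))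
      (allPairs-≢ (maximal-members-disjoint proj₁) (maximals-maximal F?) (maximals-unique F?))
      Z⊆⋃
    where
    F : Subset n → Set
    F W = W ∈ᶠ 𝓜 × W ⊂ Z
    F? : Decidable F
    F? W = T? (𝓜 W) ×-dec W ⊂? Z
    Z⊆⋃ : Z ⊆ ⋃ (maximals F?)
    Z⊆⋃ z∈Z with cover z∈Z
    ... | W , W∈𝓜 , W⊂Z , z∈W with maximal-above F? (W∈𝓜 , W⊂Z)
    ...   | M , M-max , W⊆M = ∈⋃⁺ (maximals F?) (∈-maximals F? M-max) (W⊆M z∈W)

BlockIn : ∀ {n} → Family n → (Fin n → Set) → Fin n → Subset n → Set
BlockIn 𝓑 R v X = X ∈ᶠ 𝓑 × v ∈ X × Lift R X

blockIn? : ∀ {n} (𝓑 : Family n) {R} → Decidable R → ∀ v → Decidable (BlockIn 𝓑 R v)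
blockIn? 𝓑 R? v X = T? (𝓑 X) ×-dec v ∈? X ×-dec Lift? R? X

module _ {n : ℕ} {𝓑 : Family n} (𝓑-building : IsBuildingSet 𝓑) where
  open IsBuildingSet 𝓑-building

  blockIn-∪ : ∀ {R v X Y} → BlockIn 𝓑 R v X → BlockIn 𝓑 R v Y → BlockIn 𝓑 R v (X ∪ Y)
  blockIn-∪ {X = X} {Y} (X∈𝓑 , v∈X , X⊆R) (Y∈𝓑 , v∈Y , Y⊆R) =
    union X Y X∈𝓑 Y∈𝓑 (_ , x∈p∩q⁺ (v∈X , v∈Y)) ,
    x∈p∪q⁺ (inj₁ v∈X) ,
    λ y∈X∪Y → [ X⊆R , Y⊆R ]′ (x∈p∪q⁻ X Y y∈X∪Y)

  ⁅⁆-blockIn : ∀ {R v} → R v → BlockIn 𝓑 R v ⁅ v ⁆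
  ⁅⁆-blockIn {v = v} Rv = singleton v , x∈⁅x⁆ v , λ y∈⁅v⁆ → subst _ (sym (x∈⁅y⁆⇒x≡y v y∈⁅v⁆)) Rv

  ∃component : ∀ {R v} → Decidable R → R v → ∃[ C ] Maximal (BlockIn 𝓑 R v) C
  ∃component R? Rv = let (C , C-max , _) = maximal-above (blockIn? 𝓑 R? _) (⁅⁆-blockIn Rv) in C , C-max

  ⊆-component : ∀ {R v C X} → Maximal (BlockIn 𝓑 R v) C → BlockIn 𝓑 R v X → X ⊆ C
  ⊆-component {C = C} {X} C-max X-in x∈X =
    subst (_ ∈_) (maximal-⊆ C-max (blockIn-∪ X-in (proj₁ C-max)) (q⊆p∪q X C)) (p⊆p∪q C x∈X)

  component-unique : ∀ {R R′ v C C′} → (∀ {y} → R y → R′ y) → (∀ {y} → R′ y → R y) →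
    Maximal (BlockIn 𝓑 R v) C → Maximal (BlockIn 𝓑 R′ v) C′ → C ≡ C′
  component-unique R⇒R′ R′⇒R C-max@((C∈𝓑 , v∈C , C⊆R) , _) C′-max@((C′∈𝓑 , v∈C′ , C′⊆R′) , _) =
    ⊆-antisym (⊆-component C′-max (C∈𝓑 , v∈C , R⇒R′ ∘ C⊆R))
              (⊆-component C-max (C′∈𝓑 , v∈C′ , R′⇒R ∘ C′⊆R′))

module NestedSetFromRanking {n : ℕ} {𝓑 : Family n} (𝓑-building : IsBuildingSet 𝓑) (r : Fin n → ℕ) where
  open IsBuildingSet 𝓑-building

  Below : Fin n → Fin n → Set
  Below v y = r y ≤ r v

  C : Fin n → Subset n
  C v = proj₁ (∃component 𝓑-building (λ y → r y ≤? r v) ≤-refl)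

  C-maximal : ∀ v → Maximal (BlockIn 𝓑 (Below v) v) (C v)
  C-maximal v = proj₂ (∃component 𝓑-building (λ y → r y ≤? r v) ≤-refl)

  C∈𝓑 : ∀ v → C v ∈ᶠ 𝓑
  C∈𝓑 v = proj₁ (proj₁ (C-maximal v))

  ∈C : ∀ v → v ∈ C v
  ∈C v = proj₁ (proj₂ (proj₁ (C-maximal v)))

  C-below : ∀ v {y} → y ∈ C v → r y ≤ r v
  C-below v = proj₂ (proj₂ (proj₁ (C-maximal v)))

  ⊆C : ∀ {v X} → X ∈ᶠ 𝓑 → v ∈ X → Lift (Below v) X → X ⊆ C v
  ⊆C {v} X∈𝓑 v∈X X-below = ⊆-component 𝓑-building (C-maximal v) (X∈𝓑 , v∈X , X-below)

  C-mono : ∀ {v w} → r v ≤ r w → Nonempty (C v ∩ C w) → C v ⊆ C w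
  C-mono {v} {w} v≤w Cv∩Cw≢∅ =
    ⊆-trans (p⊆p∪q (C w))
      (⊆C (union (C v) (C w) (C∈𝓑 v) (C∈𝓑 w) Cv∩Cw≢∅) (x∈p∪q⁺ (inj₂ (∈C w)))
          (λ y∈Cv∪Cw → [ (λ y∈Cv → ≤-trans (C-below v y∈Cv) v≤w) , C-below w ]′
                          (x∈p∪q⁻ (C v) (C w) y∈Cv∪Cw)))

  C-laminar : ∀ v w → C v ⊆ C w ⊎ C w ⊆ C v ⊎ Disjoint (C v) (C w)
  C-laminar v w with nonempty? (C v ∩ C w) | ≤-total (r v) (r w)
  ... | no Cv∩Cw≡∅ | _ = inj₂ (inj₂ Cv∩Cw≡∅)
  ... | yes Cv∩Cw≢∅ | inj₁ v≤w = inj₁ (C-mono v≤w Cv∩Cw≢∅)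
  ... | yes (x , x∈Cv∩Cw) | inj₂ w≤v =
    inj₂ (inj₁ (C-mono w≤v (x , x∈p∩q⁺ (swap (x∈p∩q⁻ (C v) (C w) x∈Cv∩Cw)))))

  ∃max-rank : ∀ {Z} → Nonempty Z → ∃[ v ] v ∈ Z × Lift (Below v) Z
  ∃max-rank {Z} (z , z∈Z) =
    v , argmax-all r z∈Z (all-filter (_∈? Z) (allFin n)) ,
    λ y∈Z → All.lookup (f[xs]≤f[argmax] z zs) (∈-filter⁺ (_∈? Z) (∈-allFin _) y∈Z)
    where
    zs = filter (_∈? Z) (allFin n)
    v = argmax r z zs

  N : Family n
  N X = isYes (any? (λ v → X ≟ˢ C v))

  ∈N⁺ : ∀ {X} v → X ≡ C v → X ∈ᶠ N
  ∈N⁺ {X} v X≡Cv = fromWitness {a? = any? (λ v → X ≟ˢ C v)} (v , X≡Cv)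

  ∈N⁻ : ∀ {X} → X ∈ᶠ N → ∃[ v ] X ≡ C v
  ∈N⁻ {X} X∈N = toWitness {a? = any? (λ v → X ≟ˢ C v)} X∈N

  N-nonempty : ∀ {X} → X ∈ᶠ N → Nonempty X
  N-nonempty X∈N with ∈N⁻ X∈N
  ... | v , refl = v , ∈C v

  N-laminar : ∀ X Y → X ∈ᶠ N → Y ∈ᶠ N → X ⊆ Y ⊎ Y ⊆ X ⊎ Disjoint X Y
  N-laminar X Y X∈N Y∈N with ∈N⁻ X∈N | ∈N⁻ Y∈N
  ... | v , refl | w , refl = C-laminar v w

  N-noUnion : ∀ (Xs : List (Subset n)) → length Xs ≥ 2 →
    All (_∈ᶠ N) Xs → AllPairs Disjoint Xs → ¬ (⋃ Xs ∈ᶠ 𝓑)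
  N-noUnion [] ()
  N-noUnion Xs@(X₁ ∷ _) 2≤∣Xs∣ Xs⊆N disjoint ⋃∈𝓑
    with ∃max-rank {⋃ Xs} (let (x , x∈X₁) = N-nonempty (All.head Xs⊆N) in x , ∈⋃⁺ Xs (here refl) x∈X₁)
  ... | v , v∈⋃ , ⋃-below-v with ∈⋃⁻ Xs v∈⋃
  ...   | X , X∈Xs , v∈X with ∈N⁻ (All.lookup Xs⊆N X∈Xs)
  ...     | w , refl =
    ⋃⊈∈ 2≤∣Xs∣ (All.map N-nonempty Xs⊆N) disjoint X∈Xs
      (⊆-trans (⊆C ⋃∈𝓑 v∈⋃ ⋃-below-v) (C-mono (C-below w v∈X) (v , x∈p∩q⁺ (∈C v , v∈X))))

  N-maxBlocks : ∀ X → IsMaximalBlock 𝓑 X → X ∈ᶠ N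
  N-maxBlocks X (X∈𝓑 , X-max) with ∃max-rank (nonempty X X∈𝓑)
  ... | v , v∈X , X-below-v = ∈N⁺ v (sym (X-max (C v) (C∈𝓑 v) (⊆C X∈𝓑 v∈X X-below-v)))

  N-nested : IsNested 𝓑 N
  N-nested = record
    { sub = λ X X∈N → let (v , X≡Cv) = ∈N⁻ X∈N in subst (_∈ᶠ 𝓑) (sym X≡Cv) (C∈𝓑 v)
    ; laminar = N-laminar
    ; noUnion = N-noUnion
    ; maxBlocks = N-maxBlocks
    }

  N-maximal : (∀ {x y} → r x ≡ r y → x ≡ y) → IsMaximalNested 𝓑 N
  N-maximal r-injective = N-nested , N-maximal′
    where
    N-maximal′ : ∀ 𝓝 → IsNested 𝓑 𝓝 → (∀ X → X ∈ᶠ N → X ∈ᶠ 𝓝) → ∀ Y → Y ∈ᶠ 𝓝 → Y ∈ᶠ N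
    N-maximal′ 𝓝 𝓝-nested N⊆𝓝 Y Y∈𝓝 with ∃max-rank (nonempty Y (IsNested.sub 𝓝-nested Y Y∈𝓝))
    ... | v , v∈Y , Y-below-v with Y ≟ˢ C v
    ...   | yes Y≡Cv = ∈N⁺ v Y≡Cv
    -- Otherwise C v is properly covered by Y and the C z with z ∈ C v ∖ Y.
    ...   | no Y≢Cv = ⊥-elim (¬ProperCover 𝓝-nested (C∈𝓑 v) (v , ∈C v) cover)
      where
      Y⊆Cv : Y ⊆ C v
      Y⊆Cv = ⊆C (IsNested.sub 𝓝-nested Y Y∈𝓝) v∈Y Y-below-v
      cover : ProperCover 𝓝 (C v)
      cover {z} z∈Cv with z ∈? Y
      ... | yes z∈Y = Y , Y∈𝓝 , ⊆∧≢⇒⊂ Y⊆Cv Y≢Cv , z∈Y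
      ... | no z∉Y = C z , N⊆𝓝 (C z) (∈N⁺ z refl) , (Cz⊆Cv , v , ∈C v , v∉Cz) , ∈C z
        where
        Cz⊆Cv = C-mono (C-below v z∈Cv) (z , x∈p∩q⁺ (∈C z , z∈Cv))
        v∉Cz : v ∉ C z
        v∉Cz v∈Cz =
          z∉Y (subst (_∈ Y) (r-injective (≤-antisym (C-below z v∈Cz) (C-below v z∈Cv))) v∈Y)

module ExchangeRank {n : ℕ} (P : Subset n) (a₁ a₂ : Fin n) where

  level : Fin n → Fin 4
  level y with y ∈? P | y ≟ a₁ | y ≟ a₂
  ... | no  _ | _     | _     = 3F
  ... | yes _ | yes _ | _     = 1F
  ... | yes _ | no  _ | yes _ = 2F
  ... | yes _ | no  _ | no  _ = 0F

  -- rank y = n · level y + y: ordered by level, ties broken by index.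
  rank : Fin n → ℕ
  rank y = toℕ (combine (level y) y)

  rank-injective : ∀ {x y} → rank x ≡ rank y → x ≡ y
  rank-injective {x} {y} rx≡ry = combine-injectiveʳ (level x) x (level y) y (toℕ-injective rx≡ry)

  rank-<-by-level : ∀ {x y i j} → level x ≡ i → level y ≡ j → i F.< j → rank x < rank y
  rank-<-by-level refl refl = combine-monoˡ-< _ _

  level-outer : ∀ {y} → y ∉ P → level y ≡ 3F
  level-outer {y} y∉P with y ∈? P
  ... | yes y∈P = ⊥-elim (y∉P y∈P)
  ... | no _ = refl

  level-inner : ∀ {y} → y ∈ P → y ≢ a₁ → y ≢ a₂ → level y ≡ 0F
  level-inner {y} y∈P y≢a₁ y≢a₂ with y ∈? P | y ≟ a₁ | y ≟ a₂
  ... | no y∉P | _ | _ = ⊥-elim (y∉P y∈P)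
  ... | yes _ | yes y≡a₁ | _ = ⊥-elim (y≢a₁ y≡a₁)
  ... | yes _ | no _ | yes y≡a₂ = ⊥-elim (y≢a₂ y≡a₂)
  ... | yes _ | no _ | no _ = refl

  module _ (a₁∈P : a₁ ∈ P) (a₂∈P : a₂ ∈ P) (a₁≢a₂ : a₁ ≢ a₂) where

    level-a₁ : level a₁ ≡ 1F
    level-a₁ with a₁ ∈? P | a₁ ≟ a₁
    ... | no a₁∉P | _ = ⊥-elim (a₁∉P a₁∈P)
    ... | yes _ | no a₁≢a₁ = ⊥-elim (a₁≢a₁ refl)
    ... | yes _ | yes _ = refl

    level-a₂ : level a₂ ≡ 2F
    level-a₂ with a₂ ∈? P | a₂ ≟ a₁ | a₂ ≟ a₂
    ... | no a₂∉P | _ | _ = ⊥-elim (a₂∉P a₂∈P)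
    ... | yes _ | yes a₂≡a₁ | _ = ⊥-elim (a₁≢a₂ (sym a₂≡a₁))
    ... | yes _ | no _ | no a₂≢a₂ = ⊥-elim (a₂≢a₂ refl)
    ... | yes _ | no _ | yes _ = refl

    rank-inner<a₁ : ∀ {y} → y ∈ P → y ≢ a₁ → y ≢ a₂ → rank y < rank a₁
    rank-inner<a₁ y∈P y≢a₁ y≢a₂ = rank-<-by-level (level-inner y∈P y≢a₁ y≢a₂) level-a₁ (s≤s z≤n)

    rank-a₁<a₂ : rank a₁ < rank a₂
    rank-a₁<a₂ = rank-<-by-level level-a₁ level-a₂ (s≤s (s≤s z≤n))

    rank-a₂<outer : ∀ {y} → y ∉ P → rank a₂ < rank y
    rank-a₂<outer y∉P = rank-<-by-level level-a₂ (level-outer y∉P) (s≤s (s≤s (s≤s z≤n)))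

    ≤-a₂⁻ : ∀ {y} → rank y ≤ rank a₂ → y ∈ P
    ≤-a₂⁻ {y} y≤a₂ = decidable-stable (y ∈? P) (λ y∉P → <⇒≱ (rank-a₂<outer y∉P) y≤a₂)

    ≤-a₁⁻ : ∀ {y} → rank y ≤ rank a₁ → y ∈ P × y ≢ a₂
    ≤-a₁⁻ y≤a₁ = ≤-a₂⁻ (≤-trans y≤a₁ (<⇒≤ rank-a₁<a₂)) , λ { refl → <⇒≱ rank-a₁<a₂ y≤a₁ }

    ≤-a₁⁺ : ∀ {y} → y ∈ P → y ≢ a₂ → rank y ≤ rank a₁
    -- case rather than with: with would also abstract the tests hidden in level y.
    ≤-a₁⁺ {y} y∈P y≢a₂ = case y ≟ a₁ of λ where
      (yes refl) → ≤-refl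
      (no y≢a₁) → <⇒≤ (rank-inner<a₁ y∈P y≢a₁ y≢a₂)

    ≤-a₂⁺ : ∀ {y} → y ∈ P → rank y ≤ rank a₂
    ≤-a₂⁺ {y} y∈P = case y ≟ a₂ of λ where
      (yes refl) → ≤-refl
      (no y≢a₂) → ≤-trans (≤-a₁⁺ y∈P y≢a₂) (<⇒≤ rank-a₁<a₂)

module _ {n : ℕ} (P : Subset n) (a₁ a₂ : Fin n) where
  private
    module Rank₁ = ExchangeRank P a₁ a₂
    module Rank₂ = ExchangeRank P a₂ a₁

  rank-swap : ∀ {y} → y ≢ a₁ → y ≢ a₂ → Rank₂.rank y ≡ Rank₁.rank y
  rank-swap {y} y≢a₁ y≢a₂ = cong (λ i → toℕ (combine i y)) level-swap
    where
    level-swap : Rank₂.level y ≡ Rank₁.level y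
    level-swap = case y ∈? P of λ where
      (yes y∈P) → trans (Rank₂.level-inner y∈P y≢a₂ y≢a₁)
                        (sym (Rank₁.level-inner y∈P y≢a₁ y≢a₂))
      (no y∉P) → trans (Rank₂.level-outer y∉P) (sym (Rank₁.level-outer y∉P))

  module _ (a₁∈P : a₁ ∈ P) (a₂∈P : a₂ ∈ P) (a₁≢a₂ : a₁ ≢ a₂) where
    private
      a₂≢a₁ = a₁≢a₂ ∘ sym

    ≤-swap-pair : ∀ {v y} → v ≢ a₁ → v ≢ a₂ → y ∈ P → Rank₁.rank a₁ ≤ Rank₁.rank y →
      Rank₁.rank y ≤ Rank₁.rank v → Rank₂.rank y ≤ Rank₂.rank v
    ≤-swap-pair {v} v≢a₁ v≢a₂ y∈P a₁≤y y≤v = case v ∈? P of λ where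
      (yes v∈P) → ⊥-elim (<⇒≱ (Rank₁.rank-inner<a₁ a₁∈P a₂∈P a₁≢a₂ v∈P v≢a₁ v≢a₂)
                              (≤-trans a₁≤y y≤v))
      (no v∉P) → ≤-trans (Rank₂.≤-a₂⁺ a₂∈P a₁∈P a₂≢a₁ y∈P)
                         (<⇒≤ (Rank₂.rank-a₂<outer a₂∈P a₁∈P a₂≢a₁ v∉P))

    ≤-swap : ∀ {v} → v ≢ a₁ → v ≢ a₂ →
      ∀ {y} → Rank₁.rank y ≤ Rank₁.rank v → Rank₂.rank y ≤ Rank₂.rank v
    ≤-swap {v} v≢a₁ v≢a₂ {y} y≤v = case ((y ≟ a₁) , (y ≟ a₂)) of λ where
      (yes refl , _) → ≤-swap-pair v≢a₁ v≢a₂ a₁∈P ≤-refl y≤v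
      (no _ , yes refl) → ≤-swap-pair v≢a₁ v≢a₂ a₂∈P (<⇒≤ (Rank₁.rank-a₁<a₂ a₁∈P a₂∈P a₁≢a₂)) y≤v
      (no y≢a₁ , no y≢a₂) →
        subst₂ _≤_ (sym (rank-swap y≢a₁ y≢a₂)) (sym (rank-swap v≢a₁ v≢a₂)) y≤v

MaximalBlockBelow : ∀ {n} → Family n → Subset n → Subset n → Set
MaximalBlockBelow 𝓑 P A = A ∈ᶠ 𝓑 × A ⊂ P × (∀ C → C ∈ᶠ 𝓑 → C ⊂ P → A ⊆ C → C ≡ A)

module _ {n : ℕ} {𝓑 : Family n} where

  ∃∈∖ : ∀ {P A A′} → MaximalBlockBelow 𝓑 P A → MaximalBlockBelow 𝓑 P A′ → A ≢ A′ →
    ∃[ a ] a ∈ A × a ∉ A′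
  ∃∈∖ (_ , _ , A-max) (A′∈𝓑 , A′⊂P , _) A≢A′ = ⊈⇒∃∉ (λ A⊆A′ → A≢A′ (sym (A-max _ A′∈𝓑 A′⊂P A⊆A′)))

  parent-unique : ∀ {𝓝 A P} → IsBuildingSet 𝓑 → IsNested 𝓑 𝓝 → MaximalBlockBelow 𝓑 P A →
    A ∈ᶠ 𝓝 → P ∈ᶠ 𝓝 → IsUniqueMinimal (Above 𝓝 A) P
  parent-unique {𝓝} {A} {P} 𝓑-building 𝓝-nested (A∈𝓑 , A⊂P , A-max) A∈𝓝 P∈𝓝 = P-minimal , P-unique
    where
    open IsNested 𝓝-nested
    P-minimal : IsMinimalIn (Above 𝓝 A) P
    P-minimal = (P∈𝓝 , A⊂P) , λ C (C∈𝓝 , A⊂C) C⊆P → case C ≟ˢ P of λ where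
      (yes C≡P) → C≡P
      (no C≢P) → ⊥-elim (⊂-irref (sym (A-max C (sub C C∈𝓝) (⊆∧≢⇒⊂ C⊆P C≢P) (proj₁ A⊂C))) A⊂C)
    P-unique : ∀ Q → IsMinimalIn (Above 𝓝 A) Q → Q ≡ P
    P-unique Q ((Q∈𝓝 , A⊂Q) , Q-minimal) with laminar Q P Q∈𝓝 P∈𝓝
    ... | inj₁ Q⊆P = proj₂ P-minimal Q (Q∈𝓝 , A⊂Q) Q⊆P
    ... | inj₂ (inj₁ P⊆Q) = sym (Q-minimal P (P∈𝓝 , A⊂P) P⊆Q)
    ... | inj₂ (inj₂ Q∩P≡∅) =
      let (a , a∈A) = IsBuildingSet.nonempty 𝓑-building A A∈𝓑 in
      ⊥-elim (Q∩P≡∅ (a , x∈p∩q⁺ (proj₁ A⊂Q a∈A , proj₁ A⊂P a∈A)))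

module Exchange {n : ℕ} {𝓑 : Family n} (𝓑-building : IsBuildingSet 𝓑)
  {P A₁ A₂ : Subset n} {a₁ a₂ : Fin n} (P∈𝓑 : P ∈ᶠ 𝓑)
  (A₁-below : MaximalBlockBelow 𝓑 P A₁) (A₂-below : MaximalBlockBelow 𝓑 P A₂)
  (a₁∈A₁ : a₁ ∈ A₁) (a₂∉A₁ : a₂ ∉ A₁) (a₂∈A₂ : a₂ ∈ A₂) where

  private
    A₁⊂P = proj₁ (proj₂ A₁-below)
    A₂⊂P = proj₁ (proj₂ A₂-below)
    a₁∈P = proj₁ A₁⊂P a₁∈A₁
    a₂∈P = proj₁ A₂⊂P a₂∈A₂
    a₁≢a₂ : a₁ ≢ a₂
    a₁≢a₂ refl = a₂∉A₁ a₁∈A₁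
    a₂≢a₁ = a₁≢a₂ ∘ sym
    module Rank₁ = ExchangeRank P a₁ a₂
    module Rank₂ = ExchangeRank P a₂ a₁
    module Nest₁ = NestedSetFromRanking 𝓑-building Rank₁.rank
    module Nest₂ = NestedSetFromRanking 𝓑-building Rank₂.rank

  C₁-a₁ : Nest₁.C a₁ ≡ A₁
  C₁-a₁ = proj₂ (proj₂ A₁-below) (Nest₁.C a₁) (Nest₁.C∈𝓑 a₁) (C⊆P , a₂ , a₂∈P , a₂∉C) A₁⊆C
    where
    A₁⊆C : A₁ ⊆ Nest₁.C a₁
    A₁⊆C = Nest₁.⊆C (proj₁ A₁-below) a₁∈A₁
      (λ y∈A₁ → Rank₁.≤-a₁⁺ a₁∈P a₂∈P a₁≢a₂ (proj₁ A₁⊂P y∈A₁) λ { refl → a₂∉A₁ y∈A₁ })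
    C⊆P : Nest₁.C a₁ ⊆ P
    C⊆P y∈C = proj₁ (Rank₁.≤-a₁⁻ a₁∈P a₂∈P a₁≢a₂ (Nest₁.C-below a₁ y∈C))
    a₂∉C : a₂ ∉ Nest₁.C a₁
    a₂∉C a₂∈C = proj₂ (Rank₁.≤-a₁⁻ a₁∈P a₂∈P a₁≢a₂ (Nest₁.C-below a₁ a₂∈C)) refl

  C₁-a₂ : Nest₁.C a₂ ≡ P
  C₁-a₂ = ⊆-antisym (Rank₁.≤-a₂⁻ a₁∈P a₂∈P a₁≢a₂ ∘ Nest₁.C-below a₂)
                    (Nest₁.⊆C P∈𝓑 a₂∈P (Rank₁.≤-a₂⁺ a₁∈P a₂∈P a₁≢a₂))

  C₂-a₁ : Nest₂.C a₁ ≡ P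
  C₂-a₁ = ⊆-antisym (Rank₂.≤-a₂⁻ a₂∈P a₁∈P a₂≢a₁ ∘ Nest₂.C-below a₁)
                    (Nest₂.⊆C P∈𝓑 a₁∈P (Rank₂.≤-a₂⁺ a₂∈P a₁∈P a₂≢a₁))

  C-swap : ∀ {v} → v ≢ a₁ → v ≢ a₂ → Nest₁.C v ≡ Nest₂.C v
  C-swap {v} v≢a₁ v≢a₂ = component-unique 𝓑-building
    (λ {y} → ≤-swap P a₁ a₂ a₁∈P a₂∈P a₁≢a₂ v≢a₁ v≢a₂ {y})
    (λ {y} → ≤-swap P a₂ a₁ a₂∈P a₁∈P a₂≢a₁ v≢a₂ v≢a₁ {y})
    (Nest₁.C-maximal v) (Nest₂.C-maximal v)

  C₁≢A₂ : ∀ {v} → v ≢ a₁ → v ≢ a₂ → Nest₁.C v ≢ A₂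
  C₁≢A₂ {v} v≢a₁ v≢a₂ Cv≡A₂ =
    <⇒≱ (Rank₂.rank-inner<a₁ a₂∈P a₁∈P a₂≢a₁ v∈P v≢a₂ v≢a₁)
        (Nest₂.C-below v (subst (a₂ ∈_) (trans (sym Cv≡A₂) (C-swap v≢a₁ v≢a₂)) a₂∈A₂))
    where
    v∈P = proj₁ A₂⊂P (subst (v ∈_) Cv≡A₂ (Nest₁.∈C v))

  N-maximal : IsMaximalNested 𝓑 Nest₁.N
  N-maximal = Nest₁.N-maximal Rank₁.rank-injective

  A₁∈N : A₁ ∈ᶠ Nest₁.N
  A₁∈N = Nest₁.∈N⁺ a₁ (sym C₁-a₁)

  parent : IsUniqueMinimal (Above Nest₁.N A₁) P
  parent = parent-unique 𝓑-building Nest₁.N-nested A₁-below A₁∈N (Nest₁.∈N⁺ a₂ (sym C₁-a₂))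

  remove-⊆ : ∀ X → X ∈ᶠ Nest₁.N × X ≢ A₁ → X ∈ᶠ Nest₂.N × X ≢ A₂
  remove-⊆ X (X∈N₁ , X≢A₁) with Nest₁.∈N⁻ X∈N₁
  ... | v , refl = case ((v ≟ a₁) , (v ≟ a₂)) of λ where
    (yes refl , _) → ⊥-elim (X≢A₁ C₁-a₁)
    (no _ , yes refl) → Nest₂.∈N⁺ a₁ (trans C₁-a₂ (sym C₂-a₁)) ,
                        λ C≡A₂ → ⊂-irref (trans (sym C≡A₂) C₁-a₂) A₂⊂P
    (no v≢a₁ , no v≢a₂) → Nest₂.∈N⁺ v (C-swap v≢a₁ v≢a₂) , C₁≢A₂ v≢a₁ v≢a₂

proposition3p16 : (n : ℕ) (𝓑 : Family n) → IsBuildingSet 𝓑 →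
    (B B' P : Subset n) → B ∈ᶠ 𝓑 → B' ∈ᶠ 𝓑 → P ∈ᶠ 𝓑 → B ≢ B' →
    B ⊂ P → B' ⊂ P →
    (∀ C → C ∈ᶠ 𝓑 → C ⊂ P → B ⊆ C → C ≡ B) →
    (∀ C → C ∈ᶠ 𝓑 → C ⊂ P → B' ⊆ C → C ≡ B') →
    IsExchangeFrame 𝓑 B B' P
proposition3p16 n 𝓑 𝓑-building B B' P B∈𝓑 B'∈𝓑 P∈𝓑 B≢B' B⊂P B'⊂P B-max B'-max =
  frame (∃∈∖ B-below B'-below B≢B') (∃∈∖ B'-below B-below (B≢B' ∘ sym))
  where
  B-below : MaximalBlockBelow 𝓑 P B
  B-below = B∈𝓑 , B⊂P , B-max
  B'-below : MaximalBlockBelow 𝓑 P B'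
  B'-below = B'∈𝓑 , B'⊂P , B'-max
  frame : ∃[ b ] b ∈ B × b ∉ B' → ∃[ b' ] b' ∈ B' × b' ∉ B → IsExchangeFrame 𝓑 B B' P
  frame (b , b∈B , b∉B') (b' , b'∈B' , b'∉B) =
    _ , _ , E.N-maximal , E′.N-maximal , E.A₁∈N , E′.A₁∈N , B≢B' ,
    (λ X → E.remove-⊆ X , E′.remove-⊆ X) , E.parent , E′.parent
    where
    module E = Exchange 𝓑-building P∈𝓑 B-below B'-below b∈B b'∉B b'∈B'
    module E′ = Exchange 𝓑-building P∈𝓑 B'-below B-below b'∈B' b∉B' b∈B
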